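{- Let $n\ge 1$. There is a bijection $\varphi:\mathcal{A}_n\to\mathcal{RS}_{n-1}$ such that $\mathrm{Last}(\sigma)-1=\mathrm{Last}(\varphi(\sigma))$ for all $\sigma\in\mathcal{A}_n$; in particular, for each $1\le k\le n$, $\varphi$ restricts to a bijection from $\mathcal{A}_{n,k}=\{\sigma\in\mathcal{A}_n:\sigma_n=k\}$ onto $\mathcal{RS}_{n-1,k-1}=\{\pi\in\mathcal{RS}_{n-1}:\pi_{n-1}=k-1\}$. Moreover, $\varphi$ can be chosen to preserve the $cd$-index, i.e. the reduced variation of $\sigma$ equals the reduced variation of the augmented Simsun permutation $0\,\varphi(\sigma)$.
   Context: For a permutation $\sigma=\sigma_1\cdots\sigma_n$ of $[n]=\{1,\dots,n\}$, $\mathrm{Last}(\sigma)=\sigma_n$, and $\sigma_{[k]}$ is the subword of $\sigma$ consisting of the letters $1,\dots,k$ in the order they appear. A double descent is a triple of consecutive letters $a>b>c$; a word ends with an ascent if its last two letters $x,y$ satisfy $x<y$. $\sigma$ is an André permutation if for every $1\le k\le n$, $\sigma_{[k]}$ has no double descents and ends with an ascent (vacuous for length 1); $\mathcal{A}_n$ is the set of André permutations of $[n]$. $\sigma$ is a Simsun permutation if for every $1\le k\le n$, $\sigma_{[k]}$ has no double descents; $\mathcal{RS}_n$ is the set of Simsun permutations of $[n]$. The variation of a word $w_1\cdots w_m$ is the word $u_1\cdots u_{m-1}$ in letters $\mathtt a,\mathtt b$ with $u_i=\mathtt a$ if $w_i<w_{i+1}$ and $u_i=\mathtt b$ if $w_i>w_{i+1}$.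 The reduced variation of an André permutation is obtained from its variation by replacing each $\mathtt{ba}$ by $\mathtt d$ and then each remaining $\mathtt a$ by $\mathtt c$. For a Simsun permutation $\pi$, the augmented permutation is $0\pi$ (prepend the letter $0$), and its reduced variation is obtained from the variation of $0\pi$ by replacing each $\mathtt{ab}$ by $\mathtt d$ and then each remaining $\mathtt a$ by $\mathtt c$. -}

module Defs where

open import Data.Nat using (ℕ; zero; suc; _≤_; _<_; _>_; _∸_; _≤?_; _<?_)
open import Data.List using (List; []; _∷_; map; upTo; filter)
open import Data.List.Relation.Binary.Permutation.Propositional using (_↭_)
open import Data.Product using (_×_)
open import Data.Unit using (⊤)
open import Data.Empty using (⊥)
open import Relation.Nullary using (¬_; yes; no)
open import Relation.Binary.PropositionalEquality using (_≡_)

range1 : ℕ → List ℕ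
range1 n = map suc (upTo n)

-- σ is a permutation of [n], written as the word σ₁ ⋯ σₙ
IsPerm : ℕ → List ℕ → Set
IsPerm n σ = σ ↭ range1 n

-- Last(w) : the last letter (default 0 for the empty word; only used on non-empty words)
lastOr0 : List ℕ → ℕ
lastOr0 []           = 0
lastOr0 (x ∷ [])     = x
lastOr0 (x ∷ y ∷ ws) = lastOr0 (y ∷ ws)

restrict : ℕ → List ℕ → List ℕ
restrict k σ = filter (_≤? k) σ

NoDoubleDescent : List ℕ → Set
NoDoubleDescent (x ∷ y ∷ z ∷ ws) = ¬ (x > y × y > z) × NoDoubleDescent (y ∷ z ∷ ws)
NoDoubleDescent _ = ⊤

EndsWithAscent : List ℕ → Set
EndsWithAscent (x ∷ y ∷ []) = x < y
EndsWithAscent (x ∷ y ∷ z ∷ ws) = EndsWithAscent (y ∷ z ∷ ws)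
EndsWithAscent _ = ⊤

Andre : ℕ → List ℕ → Set
Andre n σ = IsPerm n σ ×
  (∀ k → 1 ≤ k → k ≤ n → NoDoubleDescent (restrict k σ) × EndsWithAscent (restrict k σ))

Simsun : ℕ → List ℕ → Set
Simsun n π = IsPerm n π × (∀ k → 1 ≤ k → k ≤ n → NoDoubleDescent (restrict k π))

data Letter : Set where
  𝐚 𝐛 𝐜 𝐝 : Letter

-- variation: 𝐚 for an ascent, 𝐛 for a descent (letters are distinct in permutations)
step : ℕ → ℕ → Letter
step x y with x <? y
... | yes _ = 𝐚
... | no _  = 𝐛

variation : List ℕ → List Letter
variation (x ∷ y ∷ ws) = step x y ∷ variation (y ∷ ws)
variation _ = []

reduceBA : List Letter → List Letter
reduceBA (𝐛 ∷ 𝐚 ∷ us) = 𝐝 ∷ reduceBA us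
reduceBA (𝐚 ∷ us)     = 𝐜 ∷ reduceBA us
reduceBA (u ∷ us)     = u ∷ reduceBA us
reduceBA []           = []

reduceAB : List Letter → List Letter
reduceAB (𝐚 ∷ 𝐛 ∷ us) = 𝐝 ∷ reduceAB us
reduceAB (𝐚 ∷ us)     = 𝐜 ∷ reduceAB us
reduceAB (u ∷ us)     = u ∷ reduceAB us
reduceAB []           = []

redVarAndre : List ℕ → List Letter
redVarAndre σ = reduceBA (variation σ)

redVarSimsun : List ℕ → List Letter
redVarSimsun π = reduceAB (variation (0 ∷ π))

module Submission where

-- Both families are built by inserting a new maximum letter.  An André permutation of [k+2]
-- is obtained from an André permutation τ of [k+1] by inserting k+2 into one of the
-- "André gaps" of τ (the end, or directly before the bottom of an ascent); these gaps are
-- numbered 0 … asc τ.  A Simsun permutation of [k+1] is obtained from a Simsun permutation π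
-- of [k] by inserting k+1 into one of the "Simsun gaps" (additionally: before the last
-- letter), numbered 0 … asc(0π).  The map φ erases the maximum, recursively maps the rest and
-- inserts the new maximum into the gap with the same number; its inverse does the converse.
--
-- The heart of the argument is that inserting into gap j changes the reduced variation of an
-- André permutation and of an augmented Simsun permutation by the same operation `cdInsert j`,
-- so φ preserves the cd-index by induction.  Counting the letters c and d then gives
-- asc τ = asc(0 φ(τ)), so the two ranges of gap numbers agree, which makes the constructions
-- mutually inverse.  The last-letter statement follows from where the maximum is inserted.

open import Defs
open import Data.Nat using (ℕ; zero; suc; _≤_; _<_; _>_; _∸_; _≤?_; _<?_; _≟_; z≤n; s≤s; z<s; _+_)
open import Data.Nat.Properties
open import Data.List using (List; []; _∷_; _++_; map; upTo; filter; take)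
open import Data.List.Properties using (filter-++; filter-all; filter-reject; map-++; ++-identityʳ; upTo-∷ʳ)
open import Data.List.Relation.Unary.All as All using (All; []; _∷_)
import Data.List.Relation.Unary.All.Properties as AllProperties
import Data.List.Relation.Unary.AllPairs as AllPairs
open AllPairs using ([]; _∷_)
open import Data.List.Relation.Unary.Unique.Propositional using (Unique)
import Data.List.Relation.Unary.Unique.Propositional.Properties as Unique
open import Data.List.Relation.Unary.Any using (here; there)
open import Data.List.Membership.Propositional using (_∈_)
open import Data.List.Membership.Propositional.Properties using (∈-++⁺ʳ)
open import Data.List.Relation.Binary.Permutation.Propositional
  using (_↭_; ↭-refl; ↭-sym; ↭-trans; ↭-prep; ↭⇒↭ₛ)
open import Data.List.Relation.Binary.Permutation.Propositional.Properties
  using (All-resp-↭; ∈-resp-↭; drop-mid; shift; ∷↭∷ʳ; ↭-empty-inv; ↭-singleton-inv)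
import Data.List.Relation.Binary.Permutation.Setoid.Properties as PermutationSetoid
open import Data.Product using (Σ; ∃; _×_; _,_; proj₁; proj₂)
open import Data.Sum using (inj₁; inj₂)
open import Data.Unit using (⊤; tt)
open import Function using (_∘_)
open import Relation.Nullary using (¬_; yes; no; contradiction)
open import Relation.Binary.PropositionalEquality
open import Relation.Binary.Definitions using (tri<; tri≈; tri>)

step-asc : ∀ {x y} → x < y → step x y ≡ 𝐚
step-asc {x} {y} x<y with x <? y
... | yes _   = refl
... | no x≮y = contradiction x<y x≮y

step-desc : ∀ {x y} → ¬ x < y → step x y ≡ 𝐛
step-desc {x} {y} x≮y with x <? y
... | yes x<y = contradiction x<y x≮y
... | no _    = refl

below-then-ascent : ∀ {x y z} → y < x → y ≢ z → ¬ (x > y × y > z) → y < z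
below-then-ascent {y = y} {z} y<x y≢z noDD with <-cmp y z
... | tri< y<z _ _ = y<z
... | tri≈ _ y≡z _ = contradiction y≡z y≢z
... | tri> _ _ y>z = contradiction (y<x , y>z) noDD

countA : List Letter → ℕ
countA []      = 0
countA (𝐚 ∷ w) = suc (countA w)
countA (_ ∷ w) = countA w

countA-cons : ∀ l w → countA (l ∷ w) ≡ countA (l ∷ []) + countA w
countA-cons 𝐚 w = refl
countA-cons 𝐛 w = refl
countA-cons 𝐜 w = refl
countA-cons 𝐝 w = refl

ascents : List ℕ → ℕ
ascents w = countA (variation w)

ascents-++ : ∀ u y w → ascents (u ++ y ∷ w) ≡ ascents (u ++ y ∷ []) + ascents (y ∷ w)
ascents-++ []           y w = refl
ascents-++ (x ∷ [])     y w = countA-cons (step x y) (variation (y ∷ w))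
ascents-++ (x ∷ x′ ∷ u) y w = begin
  ascents (x ∷ x′ ∷ u ++ y ∷ w)                        ≡⟨ countA-cons (step x x′) _ ⟩
  a + ascents (x′ ∷ u ++ y ∷ w)                        ≡⟨ cong (a +_) (ascents-++ (x′ ∷ u) y w) ⟩
  a + (ascents (x′ ∷ u ++ y ∷ []) + ascents (y ∷ w))   ≡⟨ sym (+-assoc a _ _) ⟩
  a + ascents (x′ ∷ u ++ y ∷ []) + ascents (y ∷ w)     ≡⟨ cong (_+ ascents (y ∷ w)) (sym (countA-cons (step x x′) _)) ⟩
  ascents (x ∷ x′ ∷ u ++ y ∷ []) + ascents (y ∷ w)     ∎
  where
  open ≡-Reasoning
  a : ℕ
  a = countA (step x x′ ∷ [])

ascents-asc : ∀ {x y} r → x < y → ascents (x ∷ y ∷ r) ≡ suc (ascents (y ∷ r))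
ascents-asc r x<y rewrite step-asc x<y = refl

-- the number of ascents of the augmented word 0π, for π with positive letters (`augAscents-0`)
augAscents : List ℕ → ℕ
augAscents []      = 0
augAscents (x ∷ w) = suc (ascents (x ∷ w))

augAscents-0 : ∀ π → All (0 <_) π → augAscents π ≡ ascents (0 ∷ π)
augAscents-0 []      _          = refl
augAscents-0 (x ∷ w) (0<x ∷ _) rewrite step-asc 0<x = refl


-- insertAndre j m τ inserts m into the j-th André gap of τ, counted from the left; the André
-- gaps are the positions directly before the bottom of an ascent, and the end.
mutual
  insertAndre : ℕ → ℕ → List ℕ → List ℕ
  insertAndre j m []          = m ∷ []
  insertAndre j m (x ∷ [])    = x ∷ m ∷ []
  insertAndre j m (x ∷ y ∷ r) = insertAndreAt (step x y) j m x (y ∷ r)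

  insertAndreAt : Letter → ℕ → ℕ → ℕ → List ℕ → List ℕ
  insertAndreAt 𝐚 zero    m x ys = m ∷ x ∷ ys
  insertAndreAt 𝐚 (suc j) m x ys = x ∷ insertAndre j m ys
  insertAndreAt _ j       m x ys = x ∷ insertAndre j m ys

-- insertSimsun j m π inserts m into the j-th Simsun gap of π: the Simsun gaps are the André
-- gaps together with the position directly before the last letter.
-- (The clause for two or more letters precedes the singleton clauses so that insertSimsun
-- unfolds on the shape of the word before looking at j.)
mutual
  insertSimsun : ℕ → ℕ → List ℕ → List ℕ
  insertSimsun j       m []          = m ∷ []
  insertSimsun j       m (x ∷ y ∷ r) = insertSimsunAt (step x y) j m x (y ∷ r)
  insertSimsun zero    m (x ∷ [])    = m ∷ x ∷ []
  insertSimsun (suc j) m (x ∷ [])    = x ∷ m ∷ []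

  insertSimsunAt : Letter → ℕ → ℕ → ℕ → List ℕ → List ℕ
  insertSimsunAt 𝐚 zero    m x ys = m ∷ x ∷ ys
  insertSimsunAt 𝐚 (suc j) m x ys = x ∷ insertSimsun j m ys
  insertSimsunAt _ j       m x ys = x ∷ insertSimsun j m ys


-- What may follow an inserted maximum: nothing or an ascent (André gaps) ...
data AndreTail : List ℕ → Set where
  end    : AndreTail []
  ascent : ∀ {y z r} → y < z → AndreTail (y ∷ z ∷ r)

-- ... and additionally a single letter (Simsun gaps).
data SimsunTail : List ℕ → Set where
  end    : SimsunTail []
  single : ∀ {y} → SimsunTail (y ∷ [])
  ascent : ∀ {y z r} → y < z → SimsunTail (y ∷ z ∷ r)

andreTail⇒simsunTail : ∀ {v} → AndreTail v → SimsunTail v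
andreTail⇒simsunTail end          = end
andreTail⇒simsunTail (ascent y<z) = ascent y<z

-- The number of the André gap u|v: the ascents of u ++ v whose bottom letter lies in u.
codeA : List ℕ → List ℕ → ℕ
codeA u v = ascents (u ++ take 1 v)

-- The number of the Simsun gap u|v; it differs from codeA only at the end, which comes after
-- the extra gap before the last letter.
codeS : List ℕ → List ℕ → ℕ
codeS u []          = augAscents u
codeS u v@(_ ∷ _)   = codeA u v

codeA≤ascents : ∀ u v → codeA u v ≤ ascents (u ++ v)
codeA≤ascents u []      = ≤-refl
codeA≤ascents u (y ∷ v) = subst (codeA u (y ∷ v) ≤_) (sym (ascents-++ u y v)) (m≤m+n _ _)

codeA<ascents : ∀ u {y z} r → y < z → codeA u (y ∷ z ∷ r) < ascents (u ++ y ∷ z ∷ r)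
codeA<ascents u {y} {z} r y<z =
  subst (codeA u (y ∷ z ∷ r) <_) (sym (ascents-++ u y (z ∷ r)))
    (m<m+n _ (subst (0 <_) (sym (ascents-asc r y<z)) z<s))

codeS≤augAscents : ∀ u v → codeS u v ≤ augAscents (u ++ v)
codeS≤augAscents []      []      = z≤n
codeS≤augAscents (x ∷ u) []      rewrite ++-identityʳ u = ≤-refl
codeS≤augAscents []      (y ∷ v) = z≤n
codeS≤augAscents (x ∷ u) (y ∷ v) = m≤n⇒m≤1+n (codeA≤ascents (x ∷ u) (y ∷ v))

codeS<augAscents : ∀ u y v → codeS u (y ∷ v) < augAscents (u ++ y ∷ v)
codeS<augAscents []      y v = z<s
codeS<augAscents (x ∷ u) y v = s≤s (codeA≤ascents (x ∷ u) (y ∷ v))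

take1-head : ∀ {y : ℕ} {r} u v → y ∷ r ≡ u ++ v → ∃ λ w → u ++ take 1 v ≡ y ∷ w
take1-head []      (y ∷ r) refl = [] , refl
take1-head (y ∷ u) v       refl = u ++ take 1 v , refl

codeA-cons : ∀ {x y r ℓ} u v → step x y ≡ ℓ → y ∷ r ≡ u ++ v →
  codeA (x ∷ u) v ≡ countA (ℓ ∷ []) + codeA u v
codeA-cons {x} {y} u v refl e with take1-head u v e
... | w , e′ rewrite e′ = countA-cons (step x y) (variation (y ∷ w))

codeS-cons : ∀ {x y r ℓ} u v → step x y ≡ ℓ → y ∷ r ≡ u ++ v →
  codeS (x ∷ u) v ≡ countA (ℓ ∷ []) + codeS u v
codeS-cons []      []          _    ()
codeS-cons {x} (y ∷ u) [] refl refl =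
  trans (cong suc (countA-cons (step x y) (variation (y ∷ u)))) (sym (+-suc _ _))
codeS-cons u       v@(_ ∷ _)   s    e    = codeA-cons u v s e

record Inserted (m : ℕ) (τ ρ : List ℕ) : Set where
  constructor gap
  field
    left right : List ℕ
    original   : τ ≡ left ++ right
    result     : ρ ≡ left ++ m ∷ right
open Inserted

gap-cons : ∀ x {m τ ρ} → Inserted m τ ρ → Inserted m (x ∷ τ) (x ∷ ρ)
gap-cons x (gap u v e₁ e₂) = gap (x ∷ u) v (cong (x ∷_) e₁) (cong (x ∷_) e₂)

-- insertAndre j m τ puts m into an André gap of τ, whose code is j whenever j ≤ asc τ.
-- (The recursive calls are made in the with-clause, where they are visibly structural.)
insertAndre-gap : ∀ j m τ → Σ (Inserted m τ (insertAndre j m τ)) λ g →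
  AndreTail (right g) × (j ≤ ascents τ → codeA (left g) (right g) ≡ j)
insertAndre-gap j m []       = gap [] [] refl refl , end , λ j≤0 → sym (n≤0⇒n≡0 j≤0)
insertAndre-gap j m (x ∷ []) = gap (x ∷ []) [] refl refl , end , λ j≤0 → sym (n≤0⇒n≡0 j≤0)
insertAndre-gap zero m (x ∷ y ∷ r) with x <? y | insertAndre-gap zero m (y ∷ r)
... | yes x<y | _ = gap [] (x ∷ y ∷ r) refl refl , ascent x<y , λ _ → refl
... | no x≮y | g , tail , code = gap-cons x g , tail , λ _ →
  trans (codeA-cons (left g) (right g) (step-desc x≮y) (original g)) (code z≤n)
insertAndre-gap (suc j) m (x ∷ y ∷ r) with x <? y | insertAndre-gap j m (y ∷ r) | insertAndre-gap (suc j) m (y ∷ r)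
... | yes x<y | g , tail , code | _ = gap-cons x g , tail , λ j<asc →
  trans (codeA-cons (left g) (right g) (step-asc x<y) (original g)) (cong suc (code (≤-pred j<asc)))
... | no x≮y | _ | g , tail , code = gap-cons x g , tail , λ j≤asc →
  trans (codeA-cons (left g) (right g) (step-desc x≮y) (original g)) (code j≤asc)

insertSimsun-gap : ∀ j m π → Σ (Inserted m π (insertSimsun j m π)) λ g →
  SimsunTail (right g) × (j ≤ augAscents π → codeS (left g) (right g) ≡ j)
insertSimsun-gap j       m []       = gap [] [] refl refl , end , λ j≤0 → sym (n≤0⇒n≡0 j≤0)
insertSimsun-gap zero    m (x ∷ []) = gap [] (x ∷ []) refl refl , single , λ _ → refl
insertSimsun-gap (suc j) m (x ∷ []) =
  gap (x ∷ []) [] refl refl , end , λ j<1 → cong suc (sym (n≤0⇒n≡0 (≤-pred j<1)))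
insertSimsun-gap zero m (x ∷ y ∷ r) with x <? y | insertSimsun-gap zero m (y ∷ r)
... | yes x<y | _ = gap [] (x ∷ y ∷ r) refl refl , ascent x<y , λ _ → refl
... | no x≮y | g , tail , code = gap-cons x g , tail , λ _ →
  trans (codeS-cons (left g) (right g) (step-desc x≮y) (original g)) (code z≤n)
insertSimsun-gap (suc j) m (x ∷ y ∷ r) with x <? y | insertSimsun-gap j m (y ∷ r) | insertSimsun-gap (suc j) m (y ∷ r)
... | yes x<y | g , tail , code | _ = gap-cons x g , tail , λ j<asc →
  trans (codeS-cons (left g) (right g) (step-asc x<y) (original g)) (cong suc (code (≤-pred j<asc)))
... | no x≮y | _ | g , tail , code = gap-cons x g , tail , λ j≤asc →
  trans (codeS-cons (left g) (right g) (step-desc x≮y) (original g)) (code j≤asc)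

insertAndre-at-code : ∀ m u v → AndreTail v → insertAndre (codeA u v) m (u ++ v) ≡ u ++ m ∷ v
insertAndre-at-code m []       []          end          = refl
insertAndre-at-code m []       (y ∷ z ∷ r) (ascent y<z) rewrite step-asc y<z = refl
insertAndre-at-code m (x ∷ []) []          end          = refl
insertAndre-at-code m (x ∷ []) (y ∷ v)     t with x <? y | insertAndre-at-code m [] (y ∷ v) t
... | yes _ | rest = cong (x ∷_) rest
... | no _  | rest = cong (x ∷_) rest
insertAndre-at-code m (x ∷ x′ ∷ u) v t with x <? x′ | insertAndre-at-code m (x′ ∷ u) v t
... | yes _ | rest = cong (x ∷_) rest
... | no _  | rest = cong (x ∷_) rest

insertSimsun-at-code : ∀ m u v → SimsunTail v → insertSimsun (codeS u v) m (u ++ v) ≡ u ++ m ∷ v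
insertSimsun-at-code m []       []          end          = refl
insertSimsun-at-code m []       (y ∷ [])    single       = refl
insertSimsun-at-code m []       (y ∷ z ∷ r) (ascent y<z) rewrite step-asc y<z = refl
insertSimsun-at-code m (x ∷ []) []          end          = refl
insertSimsun-at-code m (x ∷ []) (y ∷ v)     t with x <? y | insertSimsun-at-code m [] (y ∷ v) t
... | yes _ | rest = cong (x ∷_) rest
... | no _  | rest = cong (x ∷_) rest
insertSimsun-at-code m (x ∷ x′ ∷ u) [] t with x <? x′ | insertSimsun-at-code m (x′ ∷ u) [] t
... | yes _ | rest = cong (x ∷_) rest
... | no _  | rest = cong (x ∷_) rest
insertSimsun-at-code m (x ∷ x′ ∷ u) (y ∷ v) t with x <? x′ | insertSimsun-at-code m (x′ ∷ u) (y ∷ v) t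
... | yes _ | rest = cong (x ∷_) rest
... | no _  | rest = cong (x ∷_) rest


before : ℕ → List ℕ → List ℕ
before m []      = []
before m (x ∷ w) with x ≟ m
... | yes _ = []
... | no _  = x ∷ before m w

after : ℕ → List ℕ → List ℕ
after m []      = []
after m (x ∷ w) with x ≟ m
... | yes _ = w
... | no _  = after m w

erase : ℕ → List ℕ → List ℕ
erase m w = before m w ++ after m w

codeAOf : ℕ → List ℕ → ℕ
codeAOf m w = codeA (before m w) (after m w)

codeSOf : ℕ → List ℕ → ℕ
codeSOf m w = codeS (before m w) (after m w)

split-at : ∀ m w → m ∈ w → w ≡ before m w ++ m ∷ after m w
split-at m (x ∷ w) m∈ with x ≟ m
split-at m (x ∷ w) m∈          | yes x≡m = cong (_∷ w) x≡m
split-at m (x ∷ w) (here m≡x)  | no x≢m  = contradiction (sym m≡x) x≢m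
split-at m (x ∷ w) (there m∈w) | no x≢m  = cong (x ∷_) (split-at m w m∈w)

before-after-gap : ∀ m u v → All (_< m) u → before m (u ++ m ∷ v) ≡ u × after m (u ++ m ∷ v) ≡ v
before-after-gap m [] v [] with m ≟ m
... | yes _  = refl , refl
... | no m≢m = contradiction refl m≢m
before-after-gap m (x ∷ u) v (x<m ∷ u<m) with x ≟ m | before-after-gap m u v u<m
... | yes x≡m | _                = contradiction x≡m (<⇒≢ x<m)
... | no _    | before≡u , after≡v = cong (x ∷_) before≡u , after≡v

erase-inserted : ∀ {m τ ρ} (g : Inserted m τ ρ) → All (_< m) τ →
  erase m ρ ≡ τ × before m ρ ≡ left g × after m ρ ≡ right g
erase-inserted {m} (gap u v refl refl) τ<m with before-after-gap m u v (AllProperties.++⁻ˡ u τ<m)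
... | before≡u , after≡v rewrite before≡u | after≡v = refl , refl , refl

insertAndre-erase : ∀ j m τ → All (_< m) τ → j ≤ ascents τ →
  erase m (insertAndre j m τ) ≡ τ × codeAOf m (insertAndre j m τ) ≡ j
insertAndre-erase j m τ τ<m j≤asc with insertAndre-gap j m τ
... | g , _ , code with erase-inserted g τ<m
...   | erased , before≡ , after≡ = erased , trans (cong₂ codeA before≡ after≡) (code j≤asc)

insertSimsun-erase : ∀ j m π → All (_< m) π → j ≤ augAscents π →
  erase m (insertSimsun j m π) ≡ π × codeSOf m (insertSimsun j m π) ≡ j
insertSimsun-erase j m π π<m j≤asc with insertSimsun-gap j m π
... | g , _ , code with erase-inserted g π<m
...   | erased , before≡ , after≡ = erased , trans (cong₂ codeS before≡ after≡) (code j≤asc)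


InRange : ℕ → ℕ → Set
InRange n x = 1 ≤ x × x ≤ n

range1-snoc : ∀ n → range1 (suc n) ≡ range1 n ++ suc n ∷ []
range1-snoc n = trans (cong (map suc) (sym (upTo-∷ʳ n))) (map-++ suc (upTo n) (n ∷ []))

range1-inRange : ∀ n → All (InRange n) (range1 n)
range1-inRange n = AllProperties.map⁺ (AllProperties.applyUpTo⁺₁ (λ i → i) n (λ i<n → s≤s z≤n , i<n))

perm-inRange : ∀ {n σ} → σ ↭ range1 n → All (InRange n) σ
perm-inRange p = All-resp-↭ (↭-sym p) (range1-inRange _)

perm-below : ∀ {n σ} → σ ↭ range1 n → All (_< suc n) σ
perm-below p = All.map (s≤s ∘ proj₂) (perm-inRange p)

perm-positive : ∀ {n σ} → σ ↭ range1 n → All (0 <_) σ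
perm-positive p = All.map proj₁ (perm-inRange p)

perm-unique : ∀ {n σ} → σ ↭ range1 n → Unique σ
perm-unique {n} p = PermutationSetoid.Unique-resp-↭ (setoid ℕ) (↭⇒↭ₛ (↭-sym p))
  (Unique.map⁺ suc-injective (Unique.upTo⁺ n))

perm-erase : ∀ n σ → σ ↭ range1 (suc n) →
  σ ≡ before (suc n) σ ++ suc n ∷ after (suc n) σ × erase (suc n) σ ↭ range1 n
perm-erase n σ p = σ≡ , subst (erase (suc n) σ ↭_) (++-identityʳ (range1 n))
  (drop-mid (before (suc n) σ) (range1 n) (subst₂ _↭_ σ≡ (range1-snoc n) p))
  where
  n+1∈σ : suc n ∈ σ
  n+1∈σ = ∈-resp-↭ (↭-sym p) (subst (suc n ∈_) (sym (range1-snoc n)) (∈-++⁺ʳ (range1 n) (here refl)))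
  σ≡ : σ ≡ before (suc n) σ ++ suc n ∷ after (suc n) σ
  σ≡ = split-at (suc n) σ n+1∈σ

perm-insert : ∀ n u v → u ++ v ↭ range1 n → u ++ suc n ∷ v ↭ range1 (suc n)
perm-insert n u v p = ↭-trans (shift (suc n) u v)
  (↭-trans (↭-prep (suc n) p) (subst (suc n ∷ range1 n ↭_) (sym (range1-snoc n)) (∷↭∷ʳ (suc n) (range1 n))))

restrict-insert : ∀ {i m} u v → i < m → restrict i (u ++ m ∷ v) ≡ restrict i (u ++ v)
restrict-insert {i} {m} u v i<m = begin
  filter (_≤? i) (u ++ m ∷ v)                  ≡⟨ filter-++ (_≤? i) u (_ ∷ v) ⟩
  filter (_≤? i) u ++ filter (_≤? i) (m ∷ v)   ≡⟨ cong (filter (_≤? i) u ++_) (filter-reject (_≤? i) (<⇒≱ i<m)) ⟩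
  filter (_≤? i) u ++ filter (_≤? i) v         ≡⟨ sym (filter-++ (_≤? i) u v) ⟩
  filter (_≤? i) (u ++ v)                      ∎
  where open ≡-Reasoning

restrict-perm : ∀ {n σ} → σ ↭ range1 n → restrict n σ ≡ σ
restrict-perm p = filter-all (_≤? _) (All.map proj₂ (perm-inRange p))


noDD-tail : ∀ x w → NoDoubleDescent (x ∷ w) → NoDoubleDescent w
noDD-tail x []          _          = tt
noDD-tail x (y ∷ [])    _          = tt
noDD-tail x (y ∷ z ∷ r) (_ , noDD) = noDD

noDD-suffix : ∀ u w → NoDoubleDescent (u ++ w) → NoDoubleDescent w
noDD-suffix []      w noDD = noDD
noDD-suffix (x ∷ u) w noDD = noDD-suffix u w (noDD-tail x (u ++ w) noDD)

endsAsc-tail : ∀ x w → EndsWithAscent (x ∷ w) → EndsWithAscent w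
endsAsc-tail x []          _   = tt
endsAsc-tail x (y ∷ [])    _   = tt
endsAsc-tail x (y ∷ z ∷ r) asc = asc

endsAsc-suffix : ∀ u w → EndsWithAscent (u ++ w) → EndsWithAscent w
endsAsc-suffix []      w asc = asc
endsAsc-suffix (x ∷ u) w asc = endsAsc-suffix u w (endsAsc-tail x (u ++ w) asc)

unique-suffix : ∀ (u w : List ℕ) → Unique (u ++ w) → Unique w
unique-suffix []      w uniq       = uniq
unique-suffix (x ∷ u) w (_ ∷ uniq) = unique-suffix u w uniq

noDD-insert : ∀ m u v → All (_< m) u → SimsunTail v → NoDoubleDescent (u ++ v) →
  NoDoubleDescent (u ++ m ∷ v)
noDD-insert m []       []          _   end          _    = tt
noDD-insert m []       (y ∷ [])    _   single       _    = tt
noDD-insert m []       (y ∷ z ∷ r) _   (ascent y<z) noDD = (λ dd → <-asym y<z (proj₂ dd)) , noDD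
noDD-insert m (x ∷ []) []          _   end          _    = tt
noDD-insert m (x ∷ []) (y ∷ v) (x<m ∷ _) t noDD =
  (λ dd → <-asym x<m (proj₁ dd)) , noDD-insert m [] (y ∷ v) [] t (noDD-tail x (y ∷ v) noDD)
noDD-insert m (x ∷ x′ ∷ []) v (_ ∷ x′<m ∷ _) t noDD =
  (λ dd → <-asym x′<m (proj₂ dd)) , noDD-insert m (x′ ∷ []) v (x′<m ∷ []) t (noDD-tail x (x′ ∷ v) noDD)
noDD-insert m (x ∷ x′ ∷ x″ ∷ u) v (_ ∷ u<m) t (noDD₀ , noDD) =
  noDD₀ , noDD-insert m (x′ ∷ x″ ∷ u) v u<m t noDD

endsAsc-insert : ∀ m u v → All (_< m) u → AndreTail v → EndsWithAscent (u ++ v) →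
  EndsWithAscent (u ++ m ∷ v)
endsAsc-insert m []                []          _              end        _   = tt
endsAsc-insert m []                (y ∷ z ∷ r) _              (ascent _) asc = asc
endsAsc-insert m (x ∷ [])          []          (x<m ∷ _)      end        _   = x<m
endsAsc-insert m (x ∷ [])          (y ∷ z ∷ r) _              (ascent _) asc = asc
endsAsc-insert m (x ∷ x′ ∷ [])     []          (_ ∷ x′<m ∷ _) end        _   = x′<m
endsAsc-insert m (x ∷ x′ ∷ [])     (y ∷ z ∷ r) _              (ascent _) asc = asc
endsAsc-insert m (x ∷ x′ ∷ x″ ∷ u) v           (_ ∷ u<m)      t          asc =
  endsAsc-insert m (x′ ∷ x″ ∷ u) v u<m t asc

descent-tail : ∀ {x y} r → y < x → Unique (y ∷ r) → NoDoubleDescent (x ∷ y ∷ r) → SimsunTail (y ∷ r)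
descent-tail []      _   _               _          = single
descent-tail (z ∷ r) y<x ((y≢z ∷ _) ∷ _) (noDD , _) = ascent (below-then-ascent y<x y≢z noDD)

simsunTail-after : ∀ m v → All (_< m) v → Unique (m ∷ v) → NoDoubleDescent (m ∷ v) → SimsunTail v
simsunTail-after m []      _         _          _    = end
simsunTail-after m (y ∷ r) (y<m ∷ _) (_ ∷ uniq) noDD = descent-tail r y<m uniq noDD

andreTail-after : ∀ m v → All (_< m) v → Unique (m ∷ v) → NoDoubleDescent (m ∷ v) →
  EndsWithAscent (m ∷ v) → AndreTail v
andreTail-after m []          _         _    _    _   = end
andreTail-after m (y ∷ [])    (y<m ∷ _) _    _    m<y = contradiction m<y (<-asym y<m)
andreTail-after m (y ∷ z ∷ r) v<m       uniq noDD _   with simsunTail-after m (y ∷ z ∷ r) v<m uniq noDD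
... | ascent y<z = ascent y<z

AndreWord : List ℕ → Set
AndreWord w = NoDoubleDescent w × EndsWithAscent w

andreWord-tail : ∀ x w → AndreWord (x ∷ w) → AndreWord w
andreWord-tail x w (noDD , ends) = noDD-tail x w noDD , endsAsc-tail x w ends

-- P holds for every restriction σ_[i], 1 ≤ i ≤ n; so Andre n σ is IsPerm n σ together with
-- AllRestrictions AndreWord n σ, and Simsun n π is IsPerm n π with AllRestrictions NoDoubleDescent n π.
AllRestrictions : (List ℕ → Set) → ℕ → List ℕ → Set
AllRestrictions P n σ = ∀ i → 1 ≤ i → i ≤ n → P (restrict i σ)

restriction-whole : ∀ P {n σ} → σ ↭ range1 (suc n) → AllRestrictions P (suc n) σ → P σ
restriction-whole P p cond = subst P (restrict-perm p) (cond _ (s≤s z≤n) ≤-refl)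

restrictions-erase : ∀ P n {σ} u v → σ ≡ u ++ suc n ∷ v →
  AllRestrictions P (suc n) σ → AllRestrictions P n (u ++ v)
restrictions-erase P n u v refl cond i 1≤i i≤n =
  subst P (restrict-insert u v (s≤s i≤n)) (cond i 1≤i (m≤n⇒m≤1+n i≤n))

restrictions-insert : ∀ P n u v → u ++ suc n ∷ v ↭ range1 (suc n) →
  AllRestrictions P n (u ++ v) → P (u ++ suc n ∷ v) → AllRestrictions P (suc n) (u ++ suc n ∷ v)
restrictions-insert P n u v p cond whole i 1≤i i≤n+1 with m≤n⇒m<n∨m≡n i≤n+1
... | inj₁ i<n+1 = subst P (sym (restrict-insert u v i<n+1)) (cond i 1≤i (≤-pred i<n+1))
... | inj₂ refl  = subst P (sym (restrict-perm p)) whole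

andre-erase : ∀ k σ → Andre (2 + k) σ →
  σ ≡ before (2 + k) σ ++ (2 + k) ∷ after (2 + k) σ × Andre (suc k) (erase (2 + k) σ) ×
  AndreTail (after (2 + k) σ)
andre-erase k σ (p , cond) = σ≡ , (p′ , restrictions-erase AndreWord (suc k) u v σ≡ cond) , tail
  where
  u v : List ℕ
  u = before (2 + k) σ
  v = after (2 + k) σ
  σ≡ : σ ≡ u ++ (2 + k) ∷ v
  σ≡ = proj₁ (perm-erase (suc k) σ p)
  p′ : u ++ v ↭ range1 (suc k)
  p′ = proj₂ (perm-erase (suc k) σ p)
  whole : AndreWord (u ++ (2 + k) ∷ v)
  whole = subst AndreWord σ≡ (restriction-whole AndreWord p cond)
  tail : AndreTail v
  tail = andreTail-after (2 + k) v (AllProperties.++⁻ʳ u (perm-below p′))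
    (unique-suffix u _ (subst Unique σ≡ (perm-unique p)))
    (noDD-suffix u _ (proj₁ whole)) (endsAsc-suffix u _ (proj₂ whole))

simsun-erase : ∀ k π → Simsun (suc k) π →
  π ≡ before (suc k) π ++ suc k ∷ after (suc k) π × Simsun k (erase (suc k) π) ×
  SimsunTail (after (suc k) π)
simsun-erase k π (p , cond) = π≡ , (p′ , restrictions-erase NoDoubleDescent k u v π≡ cond) , tail
  where
  u v : List ℕ
  u = before (suc k) π
  v = after (suc k) π
  π≡ : π ≡ u ++ suc k ∷ v
  π≡ = proj₁ (perm-erase k π p)
  p′ : u ++ v ↭ range1 k
  p′ = proj₂ (perm-erase k π p)
  tail : SimsunTail v
  tail = simsunTail-after (suc k) v (AllProperties.++⁻ʳ u (perm-below p′))
    (unique-suffix u _ (subst Unique π≡ (perm-unique p)))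
    (noDD-suffix u _ (subst NoDoubleDescent π≡ (restriction-whole NoDoubleDescent p cond)))

simsun-noDD : ∀ n π → Simsun n π → NoDoubleDescent π
simsun-noDD zero    π (p , _)    rewrite ↭-empty-inv p = tt
simsun-noDD (suc n) π (p , cond) = restriction-whole NoDoubleDescent p cond

andre-insert-gap : ∀ k u v → Andre (suc k) (u ++ v) → AndreTail v → Andre (2 + k) (u ++ (2 + k) ∷ v)
andre-insert-gap k u v (p , cond) tail =
  p′ , restrictions-insert AndreWord (suc k) u v p′ cond
         (noDD-insert (2 + k) u v u<m (andreTail⇒simsunTail tail) (proj₁ whole) ,
          endsAsc-insert (2 + k) u v u<m tail (proj₂ whole))
  where
  p′ : u ++ (2 + k) ∷ v ↭ range1 (2 + k)
  p′ = perm-insert (suc k) u v p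
  whole : AndreWord (u ++ v)
  whole = restriction-whole AndreWord p cond
  u<m : All (_< 2 + k) u
  u<m = AllProperties.++⁻ˡ u (perm-below p)

simsun-insert-gap : ∀ k u v → Simsun k (u ++ v) → SimsunTail v → Simsun (suc k) (u ++ suc k ∷ v)
simsun-insert-gap k u v S@(p , cond) tail =
  p′ , restrictions-insert NoDoubleDescent k u v p′ cond
         (noDD-insert (suc k) u v (AllProperties.++⁻ˡ u (perm-below p)) tail (simsun-noDD k (u ++ v) S))
  where
  p′ : u ++ suc k ∷ v ↭ range1 (suc k)
  p′ = perm-insert k u v p

andre-insert : ∀ k j τ → Andre (suc k) τ → Andre (2 + k) (insertAndre j (2 + k) τ)
andre-insert k j τ A with insertAndre-gap j (2 + k) τ
... | gap u v refl ρ≡ , tail , _ = subst (Andre (2 + k)) (sym ρ≡) (andre-insert-gap k u v A tail)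

simsun-insert : ∀ k j π → Simsun k π → Simsun (suc k) (insertSimsun j (suc k) π)
simsun-insert k j π S with insertSimsun-gap j (suc k) π
... | gap u v refl ρ≡ , tail , _ = subst (Simsun (suc k)) (sym ρ≡) (simsun-insert-gap k u v S tail)

andre-reinsert : ∀ k σ → Andre (2 + k) σ →
  insertAndre (codeAOf (2 + k) σ) (2 + k) (erase (2 + k) σ) ≡ σ
andre-reinsert k σ A with andre-erase k σ A
... | σ≡ , _ , tail = trans (insertAndre-at-code (2 + k) _ _ tail) (sym σ≡)

simsun-reinsert : ∀ k π → Simsun (suc k) π →
  insertSimsun (codeSOf (suc k) π) (suc k) (erase (suc k) π) ≡ π
simsun-reinsert k π S with simsun-erase k π S
... | π≡ , _ , tail = trans (insertSimsun-at-code (suc k) _ _ tail) (sym π≡)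


cdInsert : ℕ → List Letter → List Letter
cdInsert _       []      = 𝐜 ∷ []
cdInsert zero    (𝐜 ∷ w) = 𝐝 ∷ w
cdInsert zero    (𝐝 ∷ w) = 𝐜 ∷ 𝐝 ∷ w
cdInsert zero    (ℓ ∷ w) = ℓ ∷ w
cdInsert (suc j) (ℓ ∷ w) = ℓ ∷ cdInsert j w

insertAndre-front : ∀ {y} m r → AndreTail (y ∷ r) → insertAndre zero m (y ∷ r) ≡ m ∷ y ∷ r
insertAndre-front m _ (ascent y<z) rewrite step-asc y<z = refl

insertAndre-pass-asc : ∀ {x y} j m r → x < y →
  insertAndre (suc j) m (x ∷ y ∷ r) ≡ x ∷ insertAndre j m (y ∷ r)
insertAndre-pass-asc j m r x<y rewrite step-asc x<y = refl

insertAndre-pass-desc : ∀ {x y} j m r → ¬ x < y →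
  insertAndre j m (x ∷ y ∷ r) ≡ x ∷ insertAndre j m (y ∷ r)
insertAndre-pass-desc j m r x≮y rewrite step-desc x≮y = refl

insertSimsun-front : ∀ {y} m r → SimsunTail (y ∷ r) → insertSimsun zero m (y ∷ r) ≡ m ∷ y ∷ r
insertSimsun-front m _ single       = refl
insertSimsun-front m _ (ascent y<z) rewrite step-asc y<z = refl

insertSimsun-pass-asc : ∀ {x y} j m r → x < y →
  insertSimsun (suc j) m (x ∷ y ∷ r) ≡ x ∷ insertSimsun j m (y ∷ r)
insertSimsun-pass-asc j m r x<y rewrite step-asc x<y = refl

insertSimsun-pass-desc : ∀ {x y} j m r → ¬ x < y →
  insertSimsun j m (x ∷ y ∷ r) ≡ x ∷ insertSimsun j m (y ∷ r)
insertSimsun-pass-desc j m r x≮y rewrite step-desc x≮y = refl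

insertSimsun-pass-tail : ∀ {y} j m r → SimsunTail (y ∷ r) →
  insertSimsun (suc j) m (y ∷ r) ≡ y ∷ insertSimsun j m r
insertSimsun-pass-tail j m _ single       = refl
insertSimsun-pass-tail j m _ (ascent y<z) = insertSimsun-pass-asc j m _ y<z

rise-into : ∀ {x m y r ρ} → Inserted m (y ∷ r) ρ → x < y → x < m → variation (x ∷ ρ) ≡ 𝐚 ∷ variation ρ
rise-into (gap []      _ refl refl) _   x<m rewrite step-asc x<m = refl
rise-into (gap (_ ∷ _) _ refl refl) x<y _   rewrite step-asc x<y = refl

rise-into-insertAndre : ∀ {x y} j m r → x < y → x < m →
  variation (x ∷ insertAndre j m (y ∷ r)) ≡ 𝐚 ∷ variation (insertAndre j m (y ∷ r))
rise-into-insertAndre j m r = rise-into (proj₁ (insertAndre-gap j m (_ ∷ r)))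

rise-into-insertSimsun : ∀ {x y} j m r → x < y → x < m →
  variation (x ∷ insertSimsun j m (y ∷ r)) ≡ 𝐚 ∷ variation (insertSimsun j m (y ∷ r))
rise-into-insertSimsun j m r = rise-into (proj₁ (insertSimsun-gap j m (_ ∷ r)))

data AndreStart (x y : ℕ) : List ℕ → Set where
  rise   : ∀ {r} → x < y → AndreStart x y r
  valley : ∀ {z r} → y < x → y < z → AndreStart x y (z ∷ r)

andreStart : ∀ {x y} r → Unique (x ∷ y ∷ r) → AndreWord (x ∷ y ∷ r) → AndreStart x y r
andreStart {x} {y} r ((x≢y ∷ _) ∷ _) _ with <-cmp x y
... | tri< x<y _ _ = rise x<y
... | tri≈ _ x≡y _ = contradiction x≡y x≢y
andreStart []      _                   (_ , x<y)        | tri> _ _ y<x = contradiction x<y (<-asym y<x)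
andreStart (z ∷ r) (_ ∷ (y≢z ∷ _) ∷ _) ((noDD , _) , _) | tri> _ _ y<x =
  valley y<x (below-then-ascent y<x y≢z noDD)

data SimsunStart (x : ℕ) : List ℕ → Set where
  alone : SimsunStart x []
  rise  : ∀ {y r} → x < y → SimsunStart x (y ∷ r)
  fall  : ∀ {y r} → y < x → SimsunTail (y ∷ r) → SimsunStart x (y ∷ r)

simsunStart : ∀ {x} r → Unique (x ∷ r) → NoDoubleDescent (x ∷ r) → SimsunStart x r
simsunStart []      _ _ = alone
simsunStart {x} (y ∷ r) ((x≢y ∷ _) ∷ uniq) noDD with <-cmp x y
... | tri< x<y _ _ = rise x<y
... | tri≈ _ x≡y _ = contradiction x≡y x≢y
... | tri> _ _ y<x = fall y<x (descent-tail r y<x uniq noDD)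

-- Inserting m into André gap j changes the reduced variation by cdInsert j.  In each case the
-- comment shows the word after the insertion; the rewrites evaluate its steps.
cd-insertAndre : ∀ j m x r → All (_< m) (x ∷ r) → Unique (x ∷ r) → AndreWord (x ∷ r) →
  redVarAndre (insertAndre j m (x ∷ r)) ≡ cdInsert j (redVarAndre (x ∷ r))
cd-insertAndre j m x [] (x<m ∷ _) _ _ rewrite step-asc x<m = refl
cd-insertAndre zero m x (y ∷ r) (x<m ∷ y<m ∷ _) uniq word with andreStart r uniq word
-- m x y …
... | rise x<y
  rewrite insertAndre-front m (y ∷ r) (ascent x<y) | step-desc (<-asym x<m) | step-asc x<y = refl
-- x m y z …
... | valley {z} {r′} y<x y<z
  rewrite insertAndre-pass-desc 0 m (z ∷ r′) (<-asym y<x) | insertAndre-front m (z ∷ r′) (ascent y<z)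
        | step-asc x<m | step-desc (<-asym y<m) | step-asc y<z | step-desc (<-asym y<x) = refl
cd-insertAndre (suc j) m x (y ∷ r) (x<m ∷ y∷r<m) uniq@(_ ∷ uniq′) word with andreStart r uniq word
-- x (y … with m inserted)
... | rise x<y
  rewrite insertAndre-pass-asc j m r x<y | step-asc x<y =
  trans (cong reduceBA (rise-into-insertAndre j m r x<y x<m))
        (cong (𝐜 ∷_) (cd-insertAndre j m y r y∷r<m uniq′ (andreWord-tail x (y ∷ r) word)))
-- x y (z … with m inserted)
... | valley {z} {r′} y<x y<z
  rewrite insertAndre-pass-desc (suc j) m (z ∷ r′) (<-asym y<x) | insertAndre-pass-asc j m r′ y<z
        | step-desc (<-asym y<x) | step-asc y<z =
  trans (cong (λ V → reduceBA (𝐛 ∷ V)) (rise-into-insertAndre j m r′ y<z (All.head y∷r<m)))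
        (cong (𝐝 ∷_) (cd-insertAndre j m z r′ (All.tail y∷r<m) (AllPairs.tail uniq′)
                        (andreWord-tail y (z ∷ r′) (andreWord-tail x (y ∷ z ∷ r′) word))))

StartsAbove : ℕ → List ℕ → Set
StartsAbove p []      = ⊤
StartsAbove p (x ∷ _) = p < x

simsunTail-start : ∀ {y} r → SimsunTail (y ∷ r) → StartsAbove y r
simsunTail-start _ single       = tt
simsunTail-start _ (ascent y<z) = y<z

cd-insertSimsun : ∀ j m p π → p < m → StartsAbove p π → All (_< m) π → Unique π → NoDoubleDescent π →
  reduceAB (variation (p ∷ insertSimsun j m π)) ≡ cdInsert j (reduceAB (variation (p ∷ π)))
cd-insertSimsun j m p [] p<m _ _ _ _ rewrite step-asc p<m = refl
cd-insertSimsun zero m p (x ∷ r) p<m p<x (x<m ∷ r<m) uniq noDD with simsunStart r uniq noDD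
-- p m x
... | alone rewrite step-asc p<m | step-desc (<-asym x<m) | step-asc p<x = refl
-- p m x y …
... | rise {y} {r′} x<y
  rewrite insertSimsun-front m (y ∷ r′) (ascent x<y)
        | step-asc p<m | step-desc (<-asym x<m) | step-asc x<y | step-asc p<x = refl
-- p x m y …
... | fall {y} {r′} y<x tail
  rewrite insertSimsun-pass-desc 0 m r′ (<-asym y<x) | insertSimsun-front m r′ tail
        | step-asc p<x | step-asc x<m | step-desc (<-asym (All.head r<m)) | step-desc (<-asym y<x) = refl
cd-insertSimsun (suc j) m p (x ∷ r) p<m p<x (x<m ∷ r<m) uniq@(_ ∷ uniq′) noDD
  with simsunStart r uniq noDD
-- p x m
... | alone rewrite step-asc p<x | step-asc x<m = refl
-- p x (y … with m inserted)
... | rise {y} {r′} x<y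
  rewrite insertSimsun-pass-asc j m r′ x<y | step-asc p<x | step-asc x<y = begin
  reduceAB (𝐚 ∷ variation (x ∷ ρ))      ≡⟨ cong (λ V → reduceAB (𝐚 ∷ V)) (rise-into-insertSimsun j m r′ x<y x<m) ⟩
  𝐜 ∷ reduceAB (𝐚 ∷ variation ρ)        ≡⟨ cong (λ V → 𝐜 ∷ reduceAB V) (sym (rise-into-insertSimsun j m r′ x<y x<m)) ⟩
  𝐜 ∷ reduceAB (variation (x ∷ ρ))      ≡⟨ cong (𝐜 ∷_) (cd-insertSimsun j m x (y ∷ r′) x<m x<y r<m uniq′ (noDD-tail x _ noDD)) ⟩
  𝐜 ∷ cdInsert j (reduceAB (step x y ∷ variation (y ∷ r′)))
                                         ≡⟨ cong (λ ℓ → 𝐜 ∷ cdInsert j (reduceAB (ℓ ∷ variation (y ∷ r′)))) (step-asc x<y) ⟩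
  𝐜 ∷ cdInsert j (reduceAB (𝐚 ∷ variation (y ∷ r′))) ∎
  where
  open ≡-Reasoning
  ρ : List ℕ
  ρ = insertSimsun j m (y ∷ r′)
-- p x y (… with m inserted)
... | fall {y} {r′} y<x tail
  rewrite insertSimsun-pass-desc (suc j) m r′ (<-asym y<x) | insertSimsun-pass-tail j m r′ tail
        | step-asc p<x | step-desc (<-asym y<x) =
  cong (𝐝 ∷_) (cd-insertSimsun j m y r′ (All.head r<m) (simsunTail-start r′ tail) (All.tail r<m)
                 (AllPairs.tail uniq′) (noDD-tail y r′ (noDD-tail x (y ∷ r′) noDD)))

cd-insertAndre-perm : ∀ j k τ → Andre (suc k) τ →
  redVarAndre (insertAndre j (2 + k) τ) ≡ cdInsert j (redVarAndre τ)
cd-insertAndre-perm j k [] (p , _) with ↭-empty-inv (↭-sym p)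
... | ()
cd-insertAndre-perm j k (x ∷ r) (p , cond) =
  cd-insertAndre j (2 + k) x r (perm-below p) (perm-unique p) (restriction-whole AndreWord p cond)

cd-insertSimsun-perm : ∀ j k π → Simsun k π →
  redVarSimsun (insertSimsun j (suc k) π) ≡ cdInsert j (redVarSimsun π)
cd-insertSimsun-perm j k π S@(p , _) =
  cd-insertSimsun j (suc k) 0 π z<s (startsAbove-0 π (perm-positive p)) (perm-below p) (perm-unique p)
    (simsun-noDD k π S)
  where
  startsAbove-0 : ∀ w → All (0 <_) w → StartsAbove 0 w
  startsAbove-0 []      _         = tt
  startsAbove-0 (x ∷ _) (0<x ∷ _) = 0<x


countCD : List Letter → ℕ
countCD []      = 0
countCD (𝐜 ∷ w) = suc (countCD w)
countCD (𝐝 ∷ w) = suc (countCD w)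
countCD (_ ∷ w) = countCD w

data IsAB : Letter → Set where
  isA : IsAB 𝐚
  isB : IsAB 𝐛

variation-AB : ∀ w → All IsAB (variation w)
variation-AB []          = []
variation-AB (x ∷ [])    = []
variation-AB (x ∷ y ∷ r) = step-AB ∷ variation-AB (y ∷ r)
  where
  step-AB : IsAB (step x y)
  step-AB with x <? y
  ... | yes _ = isA
  ... | no _  = isB

-- Both reductions turn each 𝐚 of an a,b-word into exactly one of the letters c, d.
countCD-reduceBA : ∀ w → All IsAB w → countCD (reduceBA w) ≡ countA w
countCD-reduceBA []          []               = refl
countCD-reduceBA (_ ∷ w)     (isA ∷ ab)       = cong suc (countCD-reduceBA w ab)
countCD-reduceBA (_ ∷ [])    (isB ∷ [])       = refl
countCD-reduceBA (_ ∷ _ ∷ w) (isB ∷ isA ∷ ab) = cong suc (countCD-reduceBA w ab)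
countCD-reduceBA (_ ∷ _ ∷ w) (isB ∷ isB ∷ ab) = countCD-reduceBA (𝐛 ∷ w) (isB ∷ ab)

countCD-reduceAB : ∀ w → All IsAB w → countCD (reduceAB w) ≡ countA w
countCD-reduceAB []          []               = refl
countCD-reduceAB (_ ∷ [])    (isA ∷ [])       = refl
countCD-reduceAB (_ ∷ _ ∷ w) (isA ∷ isB ∷ ab) = cong suc (countCD-reduceAB w ab)
countCD-reduceAB (_ ∷ _ ∷ w) (isA ∷ isA ∷ ab) = cong suc (countCD-reduceAB (𝐚 ∷ w) (isA ∷ ab))
countCD-reduceAB (_ ∷ w)     (isB ∷ ab)       = countCD-reduceAB w ab

ascents-from-cd : ∀ σ π → All (0 <_) π → redVarAndre σ ≡ redVarSimsun π → ascents σ ≡ augAscents π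
ascents-from-cd σ π 0<π cd≡ = begin
  ascents σ                          ≡⟨ sym (countCD-reduceBA (variation σ) (variation-AB σ)) ⟩
  countCD (redVarAndre σ)            ≡⟨ cong countCD cd≡ ⟩
  countCD (redVarSimsun π)           ≡⟨ countCD-reduceAB (variation (0 ∷ π)) (variation-AB (0 ∷ π)) ⟩
  ascents (0 ∷ π)                    ≡⟨ sym (augAscents-0 π 0<π) ⟩
  augAscents π                       ∎
  where open ≡-Reasoning


lastOr0-++ : ∀ u y w → lastOr0 (u ++ y ∷ w) ≡ lastOr0 (y ∷ w)
lastOr0-++ []           y w = refl
lastOr0-++ (x ∷ [])     y w = refl
lastOr0-++ (x ∷ x′ ∷ u) y w = lastOr0-++ (x′ ∷ u) y w

last-insertSimsun-end : ∀ p j m π → j ≡ augAscents π → lastOr0 (p ∷ insertSimsun j m π) ≡ m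
last-insertSimsun-end p j m π j≡ with insertSimsun-gap j m π
... | gap u [] refl ρ≡ , _ , _ rewrite ρ≡ = lastOr0-++ (p ∷ u) m []
... | gap u (y ∷ v) refl _ , _ , code =
  contradiction (trans (code (≤-reflexive j≡)) j≡) (<⇒≢ (codeS<augAscents u y v))

last-insertSimsun-inner : ∀ p j m π → j < augAscents π →
  lastOr0 (p ∷ insertSimsun j m π) ≡ lastOr0 (p ∷ π)
last-insertSimsun-inner p j m π j< with insertSimsun-gap j m π
... | gap u [] refl _ , _ , code =
  contradiction (subst (j <_) (cong augAscents (++-identityʳ u)) j<) (<-irrefl (sym (code (<⇒≤ j<))))
... | gap u (y ∷ v) refl ρ≡ , _ , _ rewrite ρ≡ =
  trans (lastOr0-++ (p ∷ u) m (y ∷ v)) (sym (lastOr0-++ (p ∷ u) y v))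

last-insert-parallel : ∀ m u v π → AndreTail v → ascents (u ++ v) ≡ augAscents π →
  lastOr0 (u ++ v) ∸ 1 ≡ lastOr0 (0 ∷ π) →
  lastOr0 (u ++ suc m ∷ v) ∸ 1 ≡ lastOr0 (0 ∷ insertSimsun (codeA u v) m π)
last-insert-parallel m u [] π end asc≡ _ =
  trans (cong (_∸ 1) (lastOr0-++ u (suc m) [])) (sym (last-insertSimsun-end 0 (codeA u []) m π asc≡))
last-insert-parallel m u (y ∷ z ∷ r) π (ascent y<z) asc≡ last≡ = begin
  lastOr0 (u ++ suc m ∷ y ∷ z ∷ r) ∸ 1   ≡⟨ cong (_∸ 1) (lastOr0-++ u (suc m) (y ∷ z ∷ r)) ⟩
  lastOr0 (z ∷ r) ∸ 1                    ≡⟨ cong (_∸ 1) (sym (lastOr0-++ u y (z ∷ r))) ⟩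
  lastOr0 (u ++ y ∷ z ∷ r) ∸ 1           ≡⟨ last≡ ⟩
  lastOr0 (0 ∷ π)                        ≡⟨ sym (last-insertSimsun-inner 0 j m π (subst (j <_) asc≡ (codeA<ascents u r y<z))) ⟩
  lastOr0 (0 ∷ insertSimsun j m π)       ∎
  where
  open ≡-Reasoning
  j : ℕ
  j = codeA u (y ∷ z ∷ r)


-- φ on André permutations of [k+1]: erase the maximum, map the rest, insert k into the
-- Simsun gap with the same code.
toSimsun : ℕ → List ℕ → List ℕ
toSimsun zero    σ = []
toSimsun (suc k) σ = insertSimsun (codeAOf (2 + k) σ) (suc k) (toSimsun k (erase (2 + k) σ))

-- φ⁻¹ on Simsun permutations of [k]
toAndre : ℕ → List ℕ → List ℕ
toAndre zero    π = 1 ∷ []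
toAndre (suc k) π = insertAndre (codeSOf (suc k) π) (2 + k) (toAndre k (erase (suc k) π))

toSimsun-simsun : ∀ k σ → Andre (suc k) σ → Simsun k (toSimsun k σ)
toSimsun-simsun zero    σ A = ↭-refl , λ _ _ _ → tt
toSimsun-simsun (suc k) σ A =
  simsun-insert k _ _ (toSimsun-simsun k _ (proj₁ (proj₂ (andre-erase k σ A))))

toAndre-andre : ∀ k π → Simsun k π → Andre (suc k) (toAndre k π)
toAndre-andre zero    π S = ↭-refl , singleton
  where
  singleton : AllRestrictions AndreWord 1 (1 ∷ [])
  singleton i 1≤i i≤1 rewrite ≤-antisym i≤1 1≤i = tt , tt
toAndre-andre (suc k) π S =
  andre-insert k _ _ (toAndre-andre k _ (proj₁ (proj₂ (simsun-erase k π S))))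

toSimsun-cd : ∀ k σ → Andre (suc k) σ → redVarAndre σ ≡ redVarSimsun (toSimsun k σ)
toSimsun-cd zero    σ (p , _) rewrite ↭-singleton-inv p = refl
toSimsun-cd (suc k) σ A = begin
  redVarAndre σ                                  ≡⟨ cong redVarAndre (sym (andre-reinsert k σ A)) ⟩
  redVarAndre (insertAndre j (2 + k) τ)          ≡⟨ cd-insertAndre-perm j k τ A′ ⟩
  cdInsert j (redVarAndre τ)                     ≡⟨ cong (cdInsert j) (toSimsun-cd k τ A′) ⟩
  cdInsert j (redVarSimsun (toSimsun k τ))       ≡⟨ sym (cd-insertSimsun-perm j k _ (toSimsun-simsun k τ A′)) ⟩
  redVarSimsun (toSimsun (suc k) σ)              ∎
  where
  open ≡-Reasoning
  τ : List ℕ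
  τ = erase (2 + k) σ
  j : ℕ
  j = codeAOf (2 + k) σ
  A′ : Andre (suc k) τ
  A′ = proj₁ (proj₂ (andre-erase k σ A))

-- the two ranges of gap codes agree
toSimsun-ascents : ∀ k τ → Andre (suc k) τ → ascents τ ≡ augAscents (toSimsun k τ)
toSimsun-ascents k τ A = ascents-from-cd τ _ (perm-positive (proj₁ (toSimsun-simsun k τ A))) (toSimsun-cd k τ A)

toAndre∘toSimsun : ∀ k σ → Andre (suc k) σ → toAndre k (toSimsun k σ) ≡ σ
toAndre∘toSimsun zero    σ (p , _) = sym (↭-singleton-inv p)
toAndre∘toSimsun (suc k) σ A = begin
  insertAndre (codeSOf (suc k) ρ) (2 + k) (toAndre k (erase (suc k) ρ))
      ≡⟨ cong₂ (λ c w → insertAndre c (2 + k) (toAndre k w)) (proj₂ erased) (proj₁ erased) ⟩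
  insertAndre j (2 + k) (toAndre k π)   ≡⟨ cong (insertAndre j (2 + k)) (toAndre∘toSimsun k τ A′) ⟩
  insertAndre j (2 + k) τ               ≡⟨ andre-reinsert k σ A ⟩
  σ                                     ∎
  where
  open ≡-Reasoning
  τ π ρ : List ℕ
  τ = erase (2 + k) σ
  π = toSimsun k τ
  j : ℕ
  j = codeAOf (2 + k) σ
  ρ = insertSimsun j (suc k) π
  A′ : Andre (suc k) τ
  A′ = proj₁ (proj₂ (andre-erase k σ A))
  erased : erase (suc k) ρ ≡ π × codeSOf (suc k) ρ ≡ j
  erased = insertSimsun-erase j (suc k) π (perm-below (proj₁ (toSimsun-simsun k τ A′)))
    (≤-trans (codeA≤ascents (before (2 + k) σ) (after (2 + k) σ)) (≤-reflexive (toSimsun-ascents k τ A′)))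

toSimsun∘toAndre : ∀ k π → Simsun k π → toSimsun k (toAndre k π) ≡ π
toSimsun∘toAndre zero    π (p , _) = sym (↭-empty-inv p)
toSimsun∘toAndre (suc k) π S = begin
  insertSimsun (codeAOf (2 + k) ρ) (suc k) (toSimsun k (erase (2 + k) ρ))
      ≡⟨ cong₂ (λ c w → insertSimsun c (suc k) (toSimsun k w)) (proj₂ erased) (proj₁ erased) ⟩
  insertSimsun j (suc k) (toSimsun k τ)   ≡⟨ cong (insertSimsun j (suc k)) τ↦π′ ⟩
  insertSimsun j (suc k) π′               ≡⟨ simsun-reinsert k π S ⟩
  π                                       ∎
  where
  open ≡-Reasoning
  π′ τ ρ : List ℕ
  π′ = erase (suc k) π
  τ = toAndre k π′
  j : ℕ
  j = codeSOf (suc k) π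
  ρ = insertAndre j (2 + k) τ
  S′ : Simsun k π′
  S′ = proj₁ (proj₂ (simsun-erase k π S))
  A′ : Andre (suc k) τ
  A′ = toAndre-andre k π′ S′
  τ↦π′ : toSimsun k τ ≡ π′
  τ↦π′ = toSimsun∘toAndre k π′ S′
  erased : erase (2 + k) ρ ≡ τ × codeAOf (2 + k) ρ ≡ j
  erased = insertAndre-erase j (2 + k) τ (perm-below (proj₁ A′))
    (≤-trans (codeS≤augAscents (before (suc k) π) (after (suc k) π))
      (≤-reflexive (sym (trans (toSimsun-ascents k τ A′) (cong augAscents τ↦π′)))))

toSimsun-last : ∀ k σ → Andre (suc k) σ → lastOr0 σ ∸ 1 ≡ lastOr0 (0 ∷ toSimsun k σ)
toSimsun-last zero    σ (p , _) rewrite ↭-singleton-inv p = refl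
toSimsun-last (suc k) σ A with andre-erase k σ A
... | σ≡ , A′ , tail = trans (cong (λ w → lastOr0 w ∸ 1) σ≡)
  (last-insert-parallel (suc k) (before (2 + k) σ) (after (2 + k) σ) _ tail
    (toSimsun-ascents k _ A′) (toSimsun-last k _ A′))

theorem2p7 : ∀ (n : ℕ) → 1 ≤ n →
    Σ (List ℕ → List ℕ) λ φ →
      (∀ σ → Andre n σ → Simsun (n ∸ 1) (φ σ)) ×
      (∀ σ τ → Andre n σ → Andre n τ → φ σ ≡ φ τ → σ ≡ τ) ×
      (∀ π → Simsun (n ∸ 1) π → ∃ λ σ → Andre n σ × φ σ ≡ π) ×
      (∀ σ → Andre n σ → lastOr0 σ ∸ 1 ≡ lastOr0 (0 ∷ φ σ)) ×
      (∀ σ → Andre n σ → redVarAndre σ ≡ redVarSimsun (φ σ))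
theorem2p7 zero    ()
theorem2p7 (suc k) _ =
  toSimsun k ,
  toSimsun-simsun k ,
  injective ,
  (λ π S → toAndre k π , toAndre-andre k π S , toSimsun∘toAndre k π S) ,
  toSimsun-last k ,
  toSimsun-cd k
  where
  injective : ∀ σ τ → Andre (suc k) σ → Andre (suc k) τ → toSimsun k σ ≡ toSimsun k τ → σ ≡ τ
  injective σ τ Aσ Aτ φσ≡φτ = begin
    σ                        ≡⟨ sym (toAndre∘toSimsun k σ Aσ) ⟩
    toAndre k (toSimsun k σ) ≡⟨ cong (toAndre k) φσ≡φτ ⟩
    toAndre k (toSimsun k τ) ≡⟨ toAndre∘toSimsun k τ Aτ ⟩
    τ                        ∎
    where open ≡-Reasoning
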